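{- Let $a_1>a_2>\dots>a_t>0$ be integers with $\gcd(a_1,\dots,a_t)=1$, and let $n_1,\dots,n_t$ be integers with $n_i\ge 1+2\prod_{j\ne i}a_j$ for all $1\le i\le t$. Then $[q;\underbrace{a_1,\dots,a_1}_{n_1},\dots,\underbrace{a_t,\dots,a_t}_{n_t}]$ with $q=\prod_{j=1}^t a_j$ is a minimum integer representation of the weighted game it defines.
   Context: A weighted game with quota $q$ and non-negative weights $w_i$ declares a coalition $U$ winning iff $\sum_{i\in U}w_i\ge q$. An integer representation $[q;w_1,\dots,w_n]$ of the game has non-negative integer weights and integer quota with winning coalitions of weight $\ge q$ and losing ones of weight $\le q-1$. It is a minimum integer representation if every integer representation $[q';w_1',\dots,w_n']$ of the same game satisfies $w_i\le w_i'$ for all $i$. -}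

module Defs where

open import Data.Bool using (Bool; true; false; if_then_else_)
open import Data.Nat using (ℕ; zero; suc; _≤_; _<_; _*_)
open import Data.Nat.GCD using (gcd)
open import Data.Fin using (Fin; toℕ; _≟_)
open import Data.Fin.Subset using (Subset)
open import Data.Nat.ListAction using (sum; product)
open import Data.List using (List; []; _∷_; map; replicate; length; concatMap; foldr; lookup; allFin)
open import Data.Vec as Vec using ()
open import Data.Integer using (ℤ; +_) renaming (_≤_ to _≤ℤ_)
open import Data.Product using (_×_)
open import Relation.Nullary using (does)

weightOf : {n : ℕ} → (Fin n → ℕ) → Subset n → ℕ
weightOf {n} w U = sum (map (λ i → if Vec.lookup U i then w i else 0) (allFin n))

Wins : {n : ℕ} → ℤ → (Fin n → ℕ) → Subset n → Set
Wins q w U = q ≤ℤ + weightOf w U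

SameGame : {n : ℕ} → ℤ → (Fin n → ℕ) → ℤ → (Fin n → ℕ) → Set
SameGame q w q' w' = ∀ U → (Wins q w U → Wins q' w' U) × (Wins q' w' U → Wins q w U)

IsMinimumIntRep : {n : ℕ} → ℤ → (Fin n → ℕ) → Set
IsMinimumIntRep {n} q w =
  (q' : ℤ) (w' : Fin n → ℕ) → SameGame q w q' w' → (i : Fin n) → w i ≤ w' i

gcdAll : {t : ℕ} → (Fin t → ℕ) → ℕ
gcdAll {t} a = foldr gcd 0 (map a (allFin t))

prodAll : {t : ℕ} → (Fin t → ℕ) → ℕ
prodAll {t} a = product (map a (allFin t))

prodExcept : {t : ℕ} → (Fin t → ℕ) → Fin t → ℕ
prodExcept {t} a i = product (map (λ j → if does (j ≟ i) then 1 else a j) (allFin t))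

blockWeights : {t : ℕ} → (a ns : Fin t → ℕ) → List ℕ
blockWeights {t} a ns = concatMap (λ i → replicate (ns i) (a i)) (allFin t)

-- Write P = ∏ aⱼ and Pⱼ = P / aⱼ (the cofactor), and let [Q; w′] be another integer
-- representation. Any Pⱼ players of type j weigh P and win, so the average w′-weight of the type-j
-- players is at least Q / Pⱼ. Since gcd(a) = 1, Bézout followed by reduction modulo aᵢ writes
-- P − 1 = ∑ aⱼ cⱼ with cⱼ < Pⱼ and aᵢ cᵢ ≥ Pᵢ − 1; the cⱼ heaviest players of each type form a losing
-- coalition of weight P − 1, which bounds the averages from above and gives Q ≥ P. A player x of
-- type i together with the Pᵢ − 1 lightest other players of its type wins, and comparing that light
-- coalition with the cᵢ heaviest players of type i forces w′ x ≥ aᵢ.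

module Submission where

open import Defs

open import Data.Bool using (Bool; true; false; if_then_else_; _∧_; _∨_; not)
open import Data.Bool.Properties using (∧-identityʳ; ∧-zeroʳ)
open import Data.Empty using (⊥-elim)
import Data.Integer as ℤ
open import Data.Integer.Properties using (drop‿+≤+)
open import Data.Fin using (Fin; zero; suc; _≟_; punchIn; cast)
open import Data.Fin.Properties using (punchInᵢ≢i; any?)
import Data.Nat as ℕ
open import Data.Nat hiding (_≟_)
open import Data.Nat.Properties hiding (_≟_)
open import Algebra.Properties.CommutativeSemigroup *-commutativeSemigroup using (x∙yz≈y∙xz)
open import Algebra.Properties.Semiring.Sum +-*-semiring
  using (sum; sum-cong-≗; sum-replicate-zero; sum-remove; ∑-distrib-+; ∑-comm; *-distribˡ-sum; *-distribʳ-sum)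
open import Algebra.Properties.CommutativeMonoid.Sum *-1-commutativeMonoid
  using () renaming (sum to ∏; sum-remove to ∏-remove; sum-cong-≗ to ∏-cong-≗)
open import Data.Nat.DivMod using (_%_; _/_; m≡m%n+[m/n]*n; m%n<n)
open import Data.Nat.Divisibility using (_∣_; divides; ∣m+n∣m⇒∣n; m∣m*n)
open import Data.Nat.GCD using (gcd; gcd-GCD; module Bézout)
open import Data.Nat.Tactic.RingSolver using (solve-∀)
open import Data.Product using (Σ; ∃; _×_; _,_; proj₁; proj₂)
open import Data.Sum using (_⊎_; inj₁; inj₂)
import Data.List as List
import Data.List.Properties as Listₚ
import Data.Nat.ListAction as ListAction
import Data.Nat.ListAction.Properties as ListAction
import Data.Vec as Vec
import Data.Vec.Properties as Vecₚ
open import Data.Vec.Functional using (Vector; foldr; removeAt)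
open import Function using (_∘_; id)
open import Relation.Binary.PropositionalEquality
open import Relation.Nullary using (does; yes; no; ¬?; contradiction)
open import Relation.Nullary.Decidable using (_×-dec_)

private
  variable
    n N t : ℕ
    A : Set

infixl 6 _[_]≔_

_[_]≔_ : Vector A n → Fin n → A → Vector A n
(f [ i ]≔ u) j = if does (j ≟ i) then u else f j

[]≔-updates : (f : Vector A n) (i : Fin n) (u : A) → (f [ i ]≔ u) i ≡ u
[]≔-updates f i u with i ≟ i
... | yes _ = refl
... | no i≢i = ⊥-elim (i≢i refl)

[]≔-minimal : (f : Vector A n) (i : Fin n) (u : A) {j : Fin n} → j ≢ i → (f [ i ]≔ u) j ≡ f j
[]≔-minimal f i u {j} j≢i with j ≟ i
... | yes j≡i = ⊥-elim (j≢i j≡i)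
... | no _ = refl

sum-mono-≤ : {f g : Vector ℕ n} → (∀ j → f j ≤ g j) → sum f ≤ sum g
sum-mono-≤ {zero} f≤g = z≤n
sum-mono-≤ {suc n} f≤g = +-mono-≤ (f≤g zero) (sum-mono-≤ (f≤g ∘ suc))

lookup-≤-sum : (f : Vector ℕ n) (i : Fin n) → f i ≤ sum f
lookup-≤-sum f zero = m≤m+n _ _
lookup-≤-sum f (suc i) = ≤-trans (lookup-≤-sum (f ∘ suc) i) (m≤n+m _ _)

sum-zero : {f : Vector ℕ n} → (∀ j → f j ≡ 0) → sum f ≡ 0
sum-zero {n} f≡0 = trans (sum-cong-≗ f≡0) (sum-replicate-zero n)

sum-singleton : (i : Fin n) (f : Vector ℕ n) → sum (λ j → if does (j ≟ i) then f j else 0) ≡ f i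
sum-singleton {suc n} zero f = trans (cong (f zero +_) (sum-zero {n} λ _ → refl)) (+-identityʳ (f zero))
sum-singleton {suc n} (suc i) f = sum-singleton i (f ∘ suc)

sum-[]≔ : (f : Vector ℕ n) (i : Fin n) (u : ℕ) → sum (f [ i ]≔ u) + f i ≡ sum f + u
sum-[]≔ f zero u = swap u (f zero) (sum (f ∘ suc))
  where swap : ∀ x y s → x + s + y ≡ y + s + x
        swap = solve-∀
sum-[]≔ f (suc i) u = begin
  f zero + sum ((f ∘ suc) [ i ]≔ u) + f (suc i)   ≡⟨ +-assoc (f zero) _ _ ⟩
  f zero + (sum ((f ∘ suc) [ i ]≔ u) + f (suc i)) ≡⟨ cong (f zero +_) (sum-[]≔ (f ∘ suc) i u) ⟩
  f zero + (sum (f ∘ suc) + u)                    ≡⟨ +-assoc (f zero) _ _ ⟨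
  f zero + sum (f ∘ suc) + u                      ∎
  where open ≡-Reasoning

sum-mono-≤-except : (i : Fin n) {f g : Vector ℕ n} → (∀ j → j ≢ i → f j ≤ g j) →
                    sum f + g i ≤ sum g + f i
sum-mono-≤-except i {f} {g} f≤g = begin
  sum f + g i               ≡⟨ sum-[]≔ f i (g i) ⟨
  sum (f [ i ]≔ g i) + f i  ≤⟨ +-monoˡ-≤ (f i) (sum-mono-≤ pointwise) ⟩
  sum g + f i               ∎
  where
  open ≤-Reasoning
  pointwise : ∀ j → (f [ i ]≔ g i) j ≤ g j
  pointwise j with j ≟ i
  ... | yes refl = ≤-refl
  ... | no j≢i = f≤g j j≢i

removeAt-[]≔ : (f : Vector A (suc n)) (i : Fin (suc n)) (u : A) → removeAt (f [ i ]≔ u) i ≗ removeAt f i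
removeAt-[]≔ f i u j = []≔-minimal f i u (punchInᵢ≢i i j)

sum-[]≔0 : (f : Vector ℕ (suc n)) (i : Fin (suc n)) → sum (f [ i ]≔ 0) ≡ sum (removeAt f i)
sum-[]≔0 f i = begin
  sum (f [ i ]≔ 0)                               ≡⟨ sum-remove {i = i} (f [ i ]≔ 0) ⟩
  (f [ i ]≔ 0) i + sum (removeAt (f [ i ]≔ 0) i)
    ≡⟨ cong₂ _+_ ([]≔-updates f i 0) (sum-cong-≗ (removeAt-[]≔ f i 0)) ⟩
  sum (removeAt f i)                             ∎
  where open ≡-Reasoning

∏-[]≔1 : (f : Vector ℕ (suc n)) (i : Fin (suc n)) → ∏ (f [ i ]≔ 1) ≡ ∏ (removeAt f i)
∏-[]≔1 f i = begin
  ∏ (f [ i ]≔ 1)                               ≡⟨ ∏-remove {i = i} (f [ i ]≔ 1) ⟩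
  (f [ i ]≔ 1) i * ∏ (removeAt (f [ i ]≔ 1) i)
    ≡⟨ cong₂ _*_ ([]≔-updates f i 1) (∏-cong-≗ (removeAt-[]≔ f i 1)) ⟩
  1 * ∏ (removeAt f i)                         ≡⟨ *-identityˡ _ ⟩
  ∏ (removeAt f i)                             ∎
  where open ≡-Reasoning

lookup-*-∏-[]≔1 : (f : Vector ℕ n) (i : Fin n) → f i * ∏ (f [ i ]≔ 1) ≡ ∏ f
lookup-*-∏-[]≔1 {suc n} f i = trans (cong (f i *_) (∏-[]≔1 f i)) (sym (∏-remove {i = i} f))

∏-pos : {f : Vector ℕ n} → (∀ j → 0 < f j) → 0 < ∏ f
∏-pos {zero} f>0 = z<s
∏-pos {suc n} f>0 = *-mono-< (f>0 zero) (∏-pos (f>0 ∘ suc))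

∏-[]≔1-pos : (f : Vector ℕ n) → (∀ j → 0 < f j) → (i : Fin n) → 0 < ∏ (f [ i ]≔ 1)
∏-[]≔1-pos f f>0 i = ∏-pos pointwise
  where pointwise : ∀ j → 0 < (f [ i ]≔ 1) j
        pointwise j with j ≟ i
        ... | yes _ = z<s
        ... | no _ = f>0 j

∏-≥2 : {f : Vector ℕ (suc n)} → (∀ j → 2 ≤ f j) → 2 ≤ ∏ f
∏-≥2 {f = f} f≥2 = ≤-trans (f≥2 zero) (m≤m*n (f zero) (∏ (f ∘ suc)) {{>-nonZero ∏tail>0}})
  where ∏tail>0 : 0 < ∏ (f ∘ suc)
        ∏tail>0 = ∏-pos (λ j → ≤-trans (s≤s z≤n) (f≥2 (suc j)))

+-≤-* : ∀ {x y} → 2 ≤ x → 2 ≤ y → x + y ≤ x * y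
+-≤-* {suc (suc x)} {suc (suc y)} (s≤s (s≤s _)) (s≤s (s≤s _)) =
  subst (2 + x + (2 + y) ≤_) (expand x y) (m≤m+n _ (x + y + x * y))
  where expand : ∀ x y → 2 + x + (2 + y) + (x + y + x * y) ≡ (2 + x) * (2 + y)
        expand = solve-∀

sum-≤-∏ : {f : Vector ℕ n} → (∀ j → 2 ≤ f j) → sum f ≤ ∏ f
sum-≤-∏ {zero} f≥2 = z≤n
sum-≤-∏ {suc zero} {f} f≥2 = ≤-reflexive (trans (+-identityʳ (f zero)) (sym (*-identityʳ (f zero))))
sum-≤-∏ {suc (suc n)} {f} f≥2 = begin
  f zero + sum (f ∘ suc) ≤⟨ +-monoʳ-≤ (f zero) (sum-≤-∏ (f≥2 ∘ suc)) ⟩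
  f zero + ∏ (f ∘ suc)   ≤⟨ +-≤-* (f≥2 zero) (∏-≥2 (f≥2 ∘ suc)) ⟩
  f zero * ∏ (f ∘ suc)   ∎
  where open ≤-Reasoning

sum-[]≔0-≤-∏-[]≔1 : (f : Vector ℕ n) (i : Fin n) → (∀ j → j ≢ i → 2 ≤ f j) →
                    sum (f [ i ]≔ 0) ≤ ∏ (f [ i ]≔ 1)
sum-[]≔0-≤-∏-[]≔1 {suc n} f i f≥2 = begin
  sum (f [ i ]≔ 0)   ≡⟨ sum-[]≔0 f i ⟩
  sum (removeAt f i) ≤⟨ sum-≤-∏ (λ j → f≥2 (punchIn i j) (punchInᵢ≢i i j)) ⟩
  ∏ (removeAt f i)   ≡⟨ ∏-[]≔1 f i ⟨
  ∏ (f [ i ]≔ 1)     ∎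
  where open ≤-Reasoning

gcdᵛ : Vector ℕ n → ℕ
gcdᵛ = foldr gcd 0

infixl 7 _·_

_·_ : Vector ℕ n → Vector ℕ n → ℕ
a · x = sum (λ j → a j * x j)

·-distrib-+ : (a x y : Vector ℕ n) → a · (λ j → x j + y j) ≡ a · x + a · y
·-distrib-+ a x y =
  trans (sum-cong-≗ (λ j → *-distribˡ-+ (a j) (x j) (y j))) (∑-distrib-+ (λ j → a j * x j) (λ j → a j * y j))

·-scale : (a x : Vector ℕ n) (v : ℕ) → a · (λ j → v * x j) ≡ v * (a · x)
·-scale a x v =
  trans (sum-cong-≗ (λ j → x∙yz≈y∙xz (a j) v (x j))) (sym (*-distribˡ-sum v (λ j → a j * x j)))

bézout : (a : Vector ℕ n) → Σ (Vector ℕ n × Vector ℕ n) λ (x , y) → a · x ≡ gcdᵛ a + a · y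
bézout {zero} a = ((λ ()) , (λ ())) , refl
bézout {suc n} a with bézout (a ∘ suc) | Bézout.identity (gcd-GCD (a zero) (gcdᵛ (a ∘ suc)))
... | (x , y) , eq | Bézout.+- X Y eq₂ = (x′ , y′) , identity
  where
  open ≡-Reasoning
  a′ = a ∘ suc
  g = gcdᵛ a′
  d = gcd (a zero) g
  x′ y′ : Vector ℕ (suc n)
  x′ zero = X
  x′ (suc j) = Y * y j
  y′ zero = 0
  y′ (suc j) = Y * x j
  regroup : ∀ d Y g z a₀ → d + Y * g + Y * z ≡ d + (a₀ * 0 + Y * (g + z))
  regroup = solve-∀
  identity : a · x′ ≡ d + a · y′
  identity = begin
    a zero * X + a′ · (λ j → Y * y j)       ≡⟨ cong (a zero * X +_) (·-scale a′ y Y) ⟩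
    a zero * X + Y * (a′ · y)               ≡⟨ cong (_+ Y * (a′ · y)) (trans eq₂ (*-comm X (a zero))) ⟨
    d + Y * g + Y * (a′ · y)                ≡⟨ regroup d Y g (a′ · y) (a zero) ⟩
    d + (a zero * 0 + Y * (g + a′ · y))     ≡⟨ cong (λ z → d + (a zero * 0 + Y * z)) eq ⟨
    d + (a zero * 0 + Y * (a′ · x))         ≡⟨ cong (λ z → d + (a zero * 0 + z)) (·-scale a′ x Y) ⟨
    d + (a zero * 0 + a′ · (λ j → Y * x j)) ∎
... | (x , y) , eq | Bézout.-+ X Y eq₂ = (x′ , y′) , identity
  where
  open ≡-Reasoning
  a′ = a ∘ suc
  g = gcdᵛ a′
  d = gcd (a zero) g
  x′ y′ : Vector ℕ (suc n)
  x′ zero = 0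
  x′ (suc j) = Y * x j
  y′ zero = X
  y′ (suc j) = Y * y j
  expand : ∀ a₀ Y g z → a₀ * 0 + Y * (g + z) ≡ Y * g + Y * z
  expand = solve-∀
  regroup : ∀ d X a₀ Y z → d + X * a₀ + Y * z ≡ d + (a₀ * X + Y * z)
  regroup = solve-∀
  identity : a · x′ ≡ d + a · y′
  identity = begin
    a zero * 0 + a′ · (λ j → Y * x j)       ≡⟨ cong (a zero * 0 +_) (·-scale a′ x Y) ⟩
    a zero * 0 + Y * (a′ · x)               ≡⟨ cong (λ z → a zero * 0 + Y * z) eq ⟩
    a zero * 0 + Y * (g + a′ · y)           ≡⟨ expand (a zero) Y g (a′ · y) ⟩
    Y * g + Y * (a′ · y)                    ≡⟨ cong (_+ Y * (a′ · y)) eq₂ ⟨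
    d + X * a zero + Y * (a′ · y)           ≡⟨ regroup d X (a zero) Y (a′ · y) ⟩
    d + (a zero * X + Y * (a′ · y))         ≡⟨ cong (λ z → d + (a zero * X + z)) (·-scale a′ y Y) ⟨
    d + (a zero * X + a′ · (λ j → Y * y j)) ∎

·-[]≔ : (a c : Vector ℕ n) (i : Fin n) (u : ℕ) → c i ≡ 0 → a · (c [ i ]≔ u) ≡ a · c + a i * u
·-[]≔ a c i u cᵢ≡0 = begin
  a · (c [ i ]≔ u)               ≡⟨ sum-cong-≗ pointwise ⟩
  sum (ac [ i ]≔ a i * u)        ≡⟨ +-identityʳ _ ⟨
  sum (ac [ i ]≔ a i * u) + 0    ≡⟨ cong (sum (ac [ i ]≔ a i * u) +_) aᵢcᵢ≡0 ⟨
  sum (ac [ i ]≔ a i * u) + ac i ≡⟨ sum-[]≔ ac i (a i * u) ⟩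
  a · c + a i * u                ∎
  where
  open ≡-Reasoning
  ac : Vector ℕ _
  ac j = a j * c j
  aᵢcᵢ≡0 : a i * c i ≡ 0
  aᵢcᵢ≡0 = trans (cong (a i *_) cᵢ≡0) (*-zeroʳ (a i))
  pointwise : ∀ j → a j * (c [ i ]≔ u) j ≡ (ac [ i ]≔ a i * u) j
  pointwise j with j ≟ i
  ... | yes refl = refl
  ... | no _ = refl

·-singleton : (a : Vector ℕ n) (k : Fin n) (u : ℕ) → a · ((λ _ → 0) [ k ]≔ u) ≡ a k * u
·-singleton a k u = trans (sum-cong-≗ pointwise) (sum-singleton k (λ j → a j * u))
  where
  pointwise : ∀ j → a j * ((λ _ → 0) [ k ]≔ u) j ≡ (if does (j ≟ k) then a j * u else 0)
  pointwise j with j ≟ k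
  ... | yes _ = refl
  ... | no _ = *-zeroʳ (a j)

·-mod : (a c : Vector ℕ n) (i : Fin n) .{{_ : NonZero (a i)}} →
        ∃ λ q → a · c ≡ a · ((λ j → c j % a i) [ i ]≔ 0) + a i * q
·-mod a c i = sum quotients , split
  where
  open ≡-Reasoning
  reduced : Vector ℕ _
  reduced = (λ j → c j % a i) [ i ]≔ 0
  quotients : Vector ℕ _
  quotients = (λ j → c j / a i * a j) [ i ]≔ c i
  pointwise : ∀ j → a j * c j ≡ a j * reduced j + a i * quotients j
  pointwise j with j ≟ i
  ... | yes refl = cong (_+ a i * c i) (sym (*-zeroʳ (a i)))
  ... | no _ = trans (cong (a j *_) (m≡m%n+[m/n]*n (c j) (a i))) (regroup (a j) (c j % a i) (c j / a i) (a i))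
    where regroup : ∀ aⱼ r q aᵢ → aⱼ * (r + q * aᵢ) ≡ aⱼ * r + aᵢ * (q * aⱼ)
          regroup = solve-∀
  split : a · c ≡ a · reduced + a i * sum quotients
  split = begin
    a · c                                            ≡⟨ sum-cong-≗ pointwise ⟩
    sum (λ j → a j * reduced j + a i * quotients j)
      ≡⟨ ∑-distrib-+ (λ j → a j * reduced j) (λ j → a i * quotients j) ⟩
    a · reduced + sum (λ j → a i * quotients j)
      ≡⟨ cong (a · reduced +_) (*-distribˡ-sum (a i) quotients) ⟨
    a · reduced + a i * sum quotients                ∎

PredProductCombination : Vector ℕ n → Fin n → Vector ℕ n → Set
PredProductCombination a i c = 1 + a · c ≡ ∏ a × ∏ (a [ i ]≔ 1) ≤ 1 + a i * c i

module _ (a : Vector ℕ n) (a>0 : ∀ j → 0 < a j) (i : Fin n) where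
  private
    instance
      aᵢ≢0 : NonZero (a i)
      aᵢ≢0 = >-nonZero (a>0 i)
    P = ∏ a
    cofactor = ∏ (a [ i ]≔ 1)
    α = pred (a i)

    cofactor>0 : 0 < cofactor
    cofactor>0 = ∏-[]≔1-pos a a>0 i

    ≤α*cofactor⇒+cofactor≤P : ∀ {z} → z ≤ α * cofactor → z + cofactor ≤ P
    ≤α*cofactor⇒+cofactor≤P {z} z≤ = begin
      z + cofactor              ≤⟨ +-monoˡ-≤ cofactor z≤ ⟩
      α * cofactor + cofactor   ≡⟨ +-comm (α * cofactor) cofactor ⟩
      suc α * cofactor          ≡⟨ cong (_* cofactor) (suc-pred (a i)) ⟩
      a i * cofactor            ≡⟨ lookup-*-∏-[]≔1 a i ⟩
      P                         ∎
      where open ≤-Reasoning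

  extend-combination : (c : Vector ℕ n) (e : ℕ) → c i ≡ 0 → 1 + a · c ≡ a i * e →
                       a · c + cofactor ≤ P → ∃ (PredProductCombination a i)
  extend-combination c e cᵢ≡0 1+a·c≡aᵢe bound = c′ , 1+a·c′≡P , cofactor≤
    where
    open ≤-Reasoning
    u = cofactor ∸ e
    c′ = c [ i ]≔ u
    e≤cofactor : e ≤ cofactor
    e≤cofactor = *-cancelˡ-≤ (a i) (begin
      a i * e         ≡⟨ 1+a·c≡aᵢe ⟨
      1 + a · c       ≡⟨ +-comm 1 (a · c) ⟩
      a · c + 1       ≤⟨ +-monoʳ-≤ (a · c) cofactor>0 ⟩
      a · c + cofactor ≤⟨ bound ⟩
      P               ≡⟨ lookup-*-∏-[]≔1 a i ⟨
      a i * cofactor  ∎)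
    1+a·c′≡P : 1 + a · c′ ≡ P
    1+a·c′≡P = begin-equality
      1 + a · c′                   ≡⟨ cong suc (·-[]≔ a c i u cᵢ≡0) ⟩
      1 + (a · c + a i * u)        ≡⟨ +-assoc 1 (a · c) (a i * u) ⟨
      1 + a · c + a i * u          ≡⟨ cong (_+ a i * u) 1+a·c≡aᵢe ⟩
      a i * e + a i * u            ≡⟨ *-distribˡ-+ (a i) e u ⟨
      a i * (e + u)                ≡⟨ cong (a i *_) (m+[n∸m]≡n e≤cofactor) ⟩
      a i * cofactor               ≡⟨ lookup-*-∏-[]≔1 a i ⟩
      P                            ∎
    cofactor≤ : cofactor ≤ 1 + a i * c′ i
    cofactor≤ = +-cancelˡ-≤ (a · c) _ _ (begin
      a · c + cofactor             ≤⟨ bound ⟩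
      P                            ≡⟨ 1+a·c′≡P ⟨
      1 + a · c′                   ≡⟨ cong suc (·-[]≔ a c i u cᵢ≡0) ⟩
      1 + (a · c + a i * u)        ≡⟨ cong (λ z → 1 + (a · c + a i * z)) ([]≔-updates c i u) ⟨
      1 + (a · c + a i * c′ i)     ≡⟨ +-suc (a · c) (a i * c′ i) ⟨
      a · c + (1 + a i * c′ i)     ∎)

  combination-via-unit : (k : Fin n) → k ≢ i → a k ≡ 1 → ∃ (PredProductCombination a i)
  combination-via-unit k k≢i aₖ≡1 = extend-combination c 1 cᵢ≡0 1+a·c≡aᵢ bound
    where
    c = (λ _ → 0) [ k ]≔ α
    a·c≡α : a · c ≡ α
    a·c≡α = trans (·-singleton a k α) (trans (cong (_* α) aₖ≡1) (*-identityˡ α))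
    cᵢ≡0 : c i ≡ 0
    cᵢ≡0 = []≔-minimal _ k α (k≢i ∘ sym)
    1+a·c≡aᵢ : 1 + a · c ≡ a i * 1
    1+a·c≡aᵢ = trans (cong suc a·c≡α) (trans (suc-pred (a i)) (sym (*-identityʳ (a i))))
    bound : a · c + cofactor ≤ P
    bound = ≤α*cofactor⇒+cofactor≤P
              (subst (_≤ α * cofactor) (sym a·c≡α) (m≤m*n α cofactor {{>-nonZero cofactor>0}}))

  combination-via-bézout : gcdᵛ a ≡ 1 → (∀ j → j ≢ i → 2 ≤ a j) → ∃ (PredProductCombination a i)
  -- From a · x = 1 + a · y, the coefficients y + (aᵢ − 1) x make 1 + a · c″ a multiple of aᵢ; reducing
  -- the others modulo aᵢ keeps this and bounds a · c′ by (aᵢ − 1) ∑_{j ≠ i} aⱼ ≤ (aᵢ − 1) Pᵢ.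
  combination-via-bézout gcd≡1 a≥2 with bézout a
  ... | (x , y) , a·x≡gcd+a·y with ·-mod a (λ j → y j + α * x j) i
  ... | q , a·c″≡a·c′+aᵢq = extend-combination c′ e c′ᵢ≡0 1+a·c′≡aᵢe bound
    where
    open ≤-Reasoning
    c″ c′ : Vector ℕ n
    c″ j = y j + α * x j
    c′ = (λ j → c″ j % a i) [ i ]≔ 0
    c′ᵢ≡0 : c′ i ≡ 0
    c′ᵢ≡0 = []≔-updates (λ j → c″ j % a i) i 0
    1+a·c″≡aᵢ*a·x : 1 + a · c″ ≡ a i * (a · x)
    1+a·c″≡aᵢ*a·x = begin-equality
      1 + a · c″                  ≡⟨ cong suc (·-distrib-+ a y (λ j → α * x j)) ⟩
      1 + (a · y + a · (λ j → α * x j)) ≡⟨ cong (λ z → 1 + (a · y + z)) (·-scale a x α) ⟩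
      1 + (a · y + α * (a · x))   ≡⟨ +-assoc 1 (a · y) _ ⟨
      1 + a · y + α * (a · x)     ≡⟨ cong (λ z → z + a · y + α * (a · x)) gcd≡1 ⟨
      gcdᵛ a + a · y + α * (a · x) ≡⟨ cong (_+ α * (a · x)) a·x≡gcd+a·y ⟨
      a · x + α * (a · x)         ≡⟨ cong (_* (a · x)) (suc-pred (a i)) ⟩
      a i * (a · x)               ∎
    aᵢ∣1+a·c′ : a i ∣ 1 + a · c′
    aᵢ∣1+a·c′ = ∣m+n∣m⇒∣n (divides (a · x) (trans shift (*-comm (a i) (a · x)))) (m∣m*n q)
      where shift : a i * q + (1 + a · c′) ≡ a i * (a · x)
            shift = trans (+-comm (a i * q) (1 + a · c′))
                          (trans (cong suc (sym a·c″≡a·c′+aᵢq)) 1+a·c″≡aᵢ*a·x)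
    e = _∣_.quotient aᵢ∣1+a·c′
    1+a·c′≡aᵢe : 1 + a · c′ ≡ a i * e
    1+a·c′≡aᵢe = trans (_∣_.equality aᵢ∣1+a·c′) (*-comm e (a i))
    pointwise : ∀ j → a j * c′ j ≤ α * (a [ i ]≔ 0) j
    pointwise j with j ≟ i
    ... | yes _ = ≤-reflexive (trans (*-zeroʳ (a j)) (sym (*-zeroʳ α)))
    ... | no _ = ≤-trans (*-monoʳ-≤ (a j) (<⇒≤pred (m%n<n (c″ j) (a i)))) (≤-reflexive (*-comm (a j) α))
    bound : a · c′ + cofactor ≤ P
    bound = ≤α*cofactor⇒+cofactor≤P (begin
      a · c′                          ≤⟨ sum-mono-≤ pointwise ⟩
      sum (λ j → α * (a [ i ]≔ 0) j)  ≡⟨ *-distribˡ-sum α (a [ i ]≔ 0) ⟨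
      α * sum (a [ i ]≔ 0)            ≤⟨ *-monoʳ-≤ α (sum-[]≔0-≤-∏-[]≔1 a i a≥2) ⟩
      α * cofactor                    ∎)

  pred-∏-combination : gcdᵛ a ≡ 1 → ∃ (PredProductCombination a i)
  pred-∏-combination gcd≡1 with any? (λ k → ¬? (k ≟ i) ×-dec (a k ℕ.≟ 1))
  ... | yes (k , k≢i , aₖ≡1) = combination-via-unit k k≢i aₖ≡1
  ... | no ∄unit = combination-via-bézout gcd≡1 λ j j≢i →
                     ≤∧≢⇒< (a>0 j) (λ 1≡aⱼ → ∄unit (j , j≢i , sym 1≡aⱼ))

Coalition : ℕ → Set
Coalition = Vector Bool

weight : Vector ℕ N → Coalition N → ℕ
weight w S = sum (λ p → if S p then w p else 0)

size : Coalition N → ℕ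
size = weight (λ _ → 1)

⁅_⁆ : Fin N → Coalition N
⁅ x ⁆ p = does (p ≟ x)

⁅⁆-self : (x : Fin N) → ⁅ x ⁆ x ≡ true
⁅⁆-self x with x ≟ x
... | yes _ = refl
... | no x≢x = ⊥-elim (x≢x refl)

infixl 6 _∪_ _∖_

_∪_ _∖_ : Coalition N → Coalition N → Coalition N
(S ∪ T) p = S p ∨ T p
(S ∖ T) p = S p ∧ not (T p)

infix 4 _⊆_

_⊆_ : Coalition N → Coalition N → Set
S ⊆ T = ∀ p → S p ≡ true → T p ≡ true

∖-⊆ : (S T : Coalition N) → S ∖ T ⊆ S
∖-⊆ S T p with S p
... | true = λ _ → refl

weight-cong : (w : Vector ℕ N) {S T : Coalition N} → S ≗ T → weight w S ≡ weight w T
weight-cong w S≗T = sum-cong-≗ (λ p → cong (if_then w p else 0) (S≗T p))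

weight-empty : (w : Vector ℕ N) {S : Coalition N} → (∀ p → S p ≡ false) → weight w S ≡ 0
weight-empty w S-empty = sum-zero (λ p → cong (if_then w p else 0) (S-empty p))

weight-⁅⁆ : (w : Vector ℕ N) (x : Fin N) → weight w ⁅ x ⁆ ≡ w x
weight-⁅⁆ w x = sum-singleton x w

weight-split : (w : Vector ℕ N) (S T : Coalition N) → T ⊆ S → weight w S ≡ weight w T + weight w (S ∖ T)
weight-split w S T T⊆S =
  trans (sum-cong-≗ pointwise)
        (∑-distrib-+ (λ p → if T p then w p else 0) (λ p → if (S ∖ T) p then w p else 0))
  where
  pointwise : ∀ p → (if S p then w p else 0) ≡ (if T p then w p else 0) + (if (S ∖ T) p then w p else 0)
  pointwise p with T p in Tp | S p in Sp
  ... | true  | true  = sym (+-identityʳ (w p))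
  ... | true  | false = contradiction (trans (sym (T⊆S p Tp)) Sp) λ ()
  ... | false | true  = refl
  ... | false | false = refl

weight-∖⁅⁆ : (w : Vector ℕ N) (S : Coalition N) (x : Fin N) → S x ≡ true →
             weight w S ≡ w x + weight w (S ∖ ⁅ x ⁆)
weight-∖⁅⁆ w S x x∈S =
  trans (weight-split w S ⁅ x ⁆ ⁅x⁆⊆S) (cong (_+ weight w (S ∖ ⁅ x ⁆)) (weight-⁅⁆ w x))
  where ⁅x⁆⊆S : ⁅ x ⁆ ⊆ S
        ⁅x⁆⊆S p p≡x with p ≟ x
        ... | yes refl = x∈S

weight-⁅⁆∪ : (w : Vector ℕ N) (S : Coalition N) (x : Fin N) → S x ≡ false →
             weight w (⁅ x ⁆ ∪ S) ≡ w x + weight w S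
weight-⁅⁆∪ w S x x∉S =
  trans (weight-∖⁅⁆ w (⁅ x ⁆ ∪ S) x (cong (_∨ S x) (⁅⁆-self x))) (cong (w x +_) (weight-cong w removed))
  where removed : (⁅ x ⁆ ∪ S) ∖ ⁅ x ⁆ ≗ S
        removed p with p ≟ x
        ... | yes refl = sym x∉S
        ... | no _ = ∧-identityʳ (S p)

size-≤-suc-size-∖⁅⁆ : (S : Coalition N) (x : Fin N) → size S ≤ 1 + size (S ∖ ⁅ x ⁆)
size-≤-suc-size-∖⁅⁆ S x with S x in x∈S
... | true = ≤-reflexive (weight-∖⁅⁆ (λ _ → 1) S x x∈S)
... | false = ≤-trans (≤-reflexive (weight-cong (λ _ → 1) unchanged)) (n≤1+n _)
  where unchanged : S ≗ S ∖ ⁅ x ⁆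
        unchanged p with p ≟ x
        ... | yes refl = trans x∈S (sym (∧-zeroʳ (S x)))
        ... | no _ = sym (∧-identityʳ (S p))

weight-≤-size-* : (w : Vector ℕ N) (S : Coalition N) {B : ℕ} → (∀ p → S p ≡ true → w p ≤ B) →
                  weight w S ≤ size S * B
weight-≤-size-* w S {B} w≤B = begin
  weight w S                                ≤⟨ sum-mono-≤ pointwise ⟩
  sum (λ p → B * (if S p then 1 else 0))    ≡⟨ *-distribˡ-sum B (λ p → if S p then 1 else 0) ⟨
  B * size S                                ≡⟨ *-comm B (size S) ⟩
  size S * B                                ∎
  where
  open ≤-Reasoning
  pointwise : ∀ p → (if S p then w p else 0) ≤ B * (if S p then 1 else 0)
  pointwise p with S p in p∈S
  ... | true = ≤-trans (w≤B p p∈S) (≤-reflexive (sym (*-identityʳ B)))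
  ... | false = z≤n

empty-or-heaviest : (w : Vector ℕ N) (S : Coalition N) →
  (∀ p → S p ≡ false) ⊎ ∃ λ e → S e ≡ true × (∀ p → S p ≡ true → w p ≤ w e)
empty-or-heaviest {zero} w S = inj₁ λ ()
empty-or-heaviest {suc N} w S with empty-or-heaviest (w ∘ suc) (S ∘ suc) | S zero in 0∈S
... | inj₁ empty | false = inj₁ λ { zero → 0∈S ; (suc p) → empty p }
... | inj₁ empty | true =
  inj₂ (zero , 0∈S , λ { zero _ → ≤-refl ; (suc p) p∈S → contradiction (trans (sym p∈S) (empty p)) λ () })
... | inj₂ (e , e∈S , max) | false =
  inj₂ (suc e , e∈S , λ { zero 0∈S′ → contradiction (trans (sym 0∈S′) 0∈S) λ () ; (suc p) → max p })
... | inj₂ (e , e∈S , max) | true with w (suc e) ℕ.≤? w zero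
...   | yes wₑ≤w₀ = inj₂ (zero , 0∈S , λ { zero _ → ≤-refl ; (suc p) p∈S → ≤-trans (max p p∈S) wₑ≤w₀ })
...   | no wₑ≰w₀ = inj₂ (suc e , e∈S , λ { zero _ → <⇒≤ (≰⇒> wₑ≰w₀) ; (suc p) → max p })

lightest-subcoalition : (w : Vector ℕ N) (S : Coalition N) {m : ℕ} → size S ≡ m → ∀ {k} → k ≤ m →
  ∃ λ T → T ⊆ S × size T ≡ k × m * weight w T ≤ k * weight w S
lightest-subcoalition w S {m} size≡m {k} k≤m with k ℕ.≟ m
... | yes refl = S , (λ _ → id) , size≡m , ≤-refl
lightest-subcoalition w S {zero} size≡m k≤m | no k≢m = contradiction (n≤0⇒n≡0 k≤m) k≢m
lightest-subcoalition w S {suc m} size≡m {k} k≤m | no k≢m with empty-or-heaviest w S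
... | inj₁ empty = contradiction (trans (sym (weight-empty (λ _ → 1) empty)) size≡m) 0≢1+n
... | inj₂ (e , e∈S , max)
  with lightest-subcoalition w (S ∖ ⁅ e ⁆)
         (suc-injective (trans (sym (weight-∖⁅⁆ (λ _ → 1) S e e∈S)) size≡m)) (s≤s⁻¹ (≤∧≢⇒< k≤m k≢m))
... | T , T⊆S∖e , size≡k , ineq = T , T⊆S , size≡k , bound
  where
  open ≤-Reasoning
  T⊆S : T ⊆ S
  T⊆S p = ∖-⊆ S ⁅ e ⁆ p ∘ T⊆S∖e p
  wT≤kwₑ : weight w T ≤ k * w e
  wT≤kwₑ = subst (λ z → weight w T ≤ z * w e) size≡k (weight-≤-size-* w T (λ p → max p ∘ T⊆S p))
  bound : suc m * weight w T ≤ k * weight w S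
  bound = begin
    weight w T + m * weight w T         ≤⟨ +-mono-≤ wT≤kwₑ ineq ⟩
    k * w e + k * weight w (S ∖ ⁅ e ⁆)  ≡⟨ *-distribˡ-+ k _ _ ⟨
    k * (w e + weight w (S ∖ ⁅ e ⁆))    ≡⟨ cong (k *_) (weight-∖⁅⁆ w S e e∈S) ⟨
    k * weight w S                      ∎

heaviest-subcoalition : (w : Vector ℕ N) (S : Coalition N) {m : ℕ} → size S ≡ m → ∀ {k} → k ≤ m →
  ∃ λ T → T ⊆ S × size T ≡ k × k * weight w S ≤ m * weight w T
heaviest-subcoalition w S {m} size≡m {k} k≤m with lightest-subcoalition w S size≡m (m∸n≤m m k)
... | L , L⊆S , size≡m∸k , ineq = S ∖ L , ∖-⊆ S L , size≡k , bound
  where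
  open ≤-Reasoning
  size≡k : size (S ∖ L) ≡ k
  size≡k = +-cancelˡ-≡ (m ∸ k) _ _ (begin-equality
    m ∸ k + size (S ∖ L)    ≡⟨ cong (_+ size (S ∖ L)) size≡m∸k ⟨
    size L + size (S ∖ L)   ≡⟨ weight-split (λ _ → 1) S L L⊆S ⟨
    size S                  ≡⟨ size≡m ⟩
    m                       ≡⟨ m∸n+n≡m k≤m ⟨
    m ∸ k + k               ∎)
  bound : k * weight w S ≤ m * weight w (S ∖ L)
  bound = +-cancelˡ-≤ (m * weight w L) _ _ (begin
    m * weight w L + k * weight w S     ≤⟨ +-monoˡ-≤ _ ineq ⟩
    (m ∸ k) * weight w S + k * weight w S ≡⟨ *-distribʳ-+ (weight w S) (m ∸ k) k ⟨
    (m ∸ k + k) * weight w S            ≡⟨ cong (_* weight w S) (m∸n+n≡m k≤m) ⟩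
    m * weight w S                      ≡⟨ cong (m *_) (weight-split w S L L⊆S) ⟩
    m * (weight w L + weight w (S ∖ L)) ≡⟨ *-distribˡ-+ m _ _ ⟩
    m * weight w L + m * weight w (S ∖ L) ∎)

cross-≤-trans : ∀ {m q p T c V} → 0 < m → m * q ≤ p * T → c * T ≤ m * V → c * q ≤ p * V
cross-≤-trans {m} {q} {p} {T} {c} {V} m>0 mq≤pT cT≤mV = *-cancelˡ-≤ m {{>-nonZero m>0}} (begin
  m * (c * q)  ≡⟨ x∙yz≈y∙xz m c q ⟩
  c * (m * q)  ≤⟨ *-monoʳ-≤ c mq≤pT ⟩
  c * (p * T)  ≡⟨ x∙yz≈y∙xz c p T ⟩
  p * (c * T)  ≤⟨ *-monoʳ-≤ p cT≤mV ⟩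
  p * (m * V)  ≡⟨ x∙yz≈y∙xz p m V ⟩
  m * (p * V)  ∎)
  where open ≤-Reasoning

excess-bound : ∀ {A P Q V S B} → 1 + A ≡ P → A * Q + P * V ≤ P * S + B * Q → S < Q → P * V + P ≤ Q + B * Q
excess-bound {A} {P} {Q} {V} {S} {B} 1+A≡P AQ+PV≤PS+BQ S<Q = +-cancelˡ-≤ (A * Q) _ _ (begin
  A * Q + (P * V + P)    ≡⟨ +-assoc (A * Q) (P * V) P ⟨
  A * Q + P * V + P      ≤⟨ +-monoˡ-≤ P AQ+PV≤PS+BQ ⟩
  P * S + B * Q + P      ≡⟨ regroup P S (B * Q) ⟩
  P * suc S + B * Q      ≤⟨ +-monoˡ-≤ (B * Q) (*-monoʳ-≤ P S<Q) ⟩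
  P * Q + B * Q          ≡⟨ cong (λ z → z * Q + B * Q) 1+A≡P ⟨
  (1 + A) * Q + B * Q    ≡⟨ expand A Q (B * Q) ⟩
  A * Q + (Q + B * Q)    ∎)
  where
  open ≤-Reasoning
  regroup : ∀ P S y → P * S + y + P ≡ P * suc S + y
  regroup = solve-∀
  expand : ∀ A Q y → (1 + A) * Q + y ≡ A * Q + (Q + y)
  expand = solve-∀

prod≤quota : ∀ {P Q V B} → P * V + P ≤ Q + B * Q → B * Q ≤ P * V → P ≤ Q
prod≤quota {P} {Q} {V} {B} PV+P≤Q+BQ BQ≤PV = +-cancelˡ-≤ (P * V) P Q (begin
  P * V + P    ≤⟨ PV+P≤Q+BQ ⟩
  Q + B * Q    ≤⟨ +-monoʳ-≤ Q BQ≤PV ⟩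
  Q + P * V    ≡⟨ +-comm Q (P * V) ⟩
  P * V + Q    ∎)
  where open ≤-Reasoning

combine-averages : ∀ {a K c P Q V X} → a * suc K ≡ P → P * V + P ≤ Q + a * c * Q → c * Q ≤ c * X + K * V →
                   a * c * Q + K * P ≤ P * (c * X) + K * Q
combine-averages {a} {K} {c} {P} {Q} {V} {X} P≡a[1+K] PV+P≤ cQ≤ = +-cancelˡ-≤ (K * (a * c * Q)) _ _ (begin
  K * (a * c * Q) + (a * c * Q + K * P)      ≡⟨ regroup₁ (K * (a * c * Q)) (a * c * Q) (K * P) ⟩
  (a * c * Q + K * (a * c * Q)) + K * P      ≡⟨ cong (_+ K * P) PcQ≡ ⟨
  P * (c * Q) + K * P                        ≤⟨ +-monoˡ-≤ (K * P) PcQ≤ ⟩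
  P * (c * X) + K * (P * V) + K * P          ≡⟨ +-assoc (P * (c * X)) _ _ ⟩
  P * (c * X) + (K * (P * V) + K * P)        ≤⟨ +-monoʳ-≤ (P * (c * X)) KPV+KP≤ ⟩
  P * (c * X) + (K * Q + K * (a * c * Q))    ≡⟨ regroup₂ (P * (c * X)) (K * Q) (K * (a * c * Q)) ⟩
  K * (a * c * Q) + (P * (c * X) + K * Q)    ∎)
  where
  open ≤-Reasoning
  regroup₁ : ∀ x y z → x + (y + z) ≡ y + x + z
  regroup₁ = solve-∀
  regroup₂ : ∀ x y z → x + (y + z) ≡ z + (x + y)
  regroup₂ = solve-∀
  PcQ≡ : P * (c * Q) ≡ a * c * Q + K * (a * c * Q)
  PcQ≡ = trans (cong (λ z → z * (c * Q)) (sym P≡a[1+K])) (expand a K c Q)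
    where expand : ∀ a K c Q → a * suc K * (c * Q) ≡ a * c * Q + K * (a * c * Q)
          expand = solve-∀
  PcQ≤ : P * (c * Q) ≤ P * (c * X) + K * (P * V)
  PcQ≤ = begin
    P * (c * Q)                  ≤⟨ *-monoʳ-≤ P cQ≤ ⟩
    P * (c * X + K * V)          ≡⟨ distrib P (c * X) K V ⟩
    P * (c * X) + K * (P * V)    ∎
    where distrib : ∀ P y K V → P * (y + K * V) ≡ P * y + K * (P * V)
          distrib = solve-∀
  KPV+KP≤ : K * (P * V) + K * P ≤ K * Q + K * (a * c * Q)
  KPV+KP≤ = begin
    K * (P * V) + K * P          ≡⟨ *-distribˡ-+ K _ _ ⟨
    K * (P * V + P)              ≤⟨ *-monoʳ-≤ K PV+P≤ ⟩
    K * (Q + a * c * Q)          ≡⟨ *-distribˡ-+ K _ _ ⟩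
    K * Q + K * (a * c * Q)      ∎

-- Since a c ≥ K and Q ≥ P, trading Q for P on the left only helps: (a c − K)(Q − P) ≥ 0.
≤-of-averages : ∀ {a K c P Q X} → 0 < a → 0 < c → a * suc K ≡ P → K ≤ a * c → P ≤ Q →
                a * c * Q + K * P ≤ P * (c * X) + K * Q → a ≤ X
≤-of-averages {a} {K} {c} {P} {Q} {X} a>0 c>0 P≡a[1+K] K≤ac P≤Q acQ+KP≤ =
  *-cancelʳ-≤ a X (c * P) {{>-nonZero (*-mono-< c>0 P>0)}} (subst₂ _≤_ (*-assoc a c P) (*-assoc X c P) acP≤XcP)
  where
  open ≤-Reasoning
  r = a * c ∸ K
  K+r≡ac : K + r ≡ a * c
  K+r≡ac = m+[n∸m]≡n K≤ac
  P>0 : 0 < P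
  P>0 = subst (0 <_) P≡a[1+K] (*-mono-< a>0 z<s)
  regroup₁ : ∀ K r P Q → (K + r) * P + K * Q ≡ r * P + K * P + K * Q
  regroup₁ = solve-∀
  regroup₂ : ∀ r Q K P → r * Q + K * P + K * Q ≡ (K + r) * Q + K * P
  regroup₂ = solve-∀
  rotate : ∀ P c X → P * (c * X) ≡ X * c * P
  rotate = solve-∀
  acP≤XcP : a * c * P ≤ X * c * P
  acP≤XcP = +-cancelʳ-≤ (K * Q) _ _ (begin
    a * c * P + K * Q          ≡⟨ cong (λ z → z * P + K * Q) K+r≡ac ⟨
    (K + r) * P + K * Q        ≡⟨ regroup₁ K r P Q ⟩
    r * P + K * P + K * Q      ≤⟨ +-monoˡ-≤ (K * Q) (+-monoˡ-≤ (K * P) (*-monoʳ-≤ r P≤Q)) ⟩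
    r * Q + K * P + K * Q      ≡⟨ regroup₂ r Q K P ⟩
    (K + r) * Q + K * P        ≡⟨ cong (λ z → z * Q + K * P) K+r≡ac ⟩
    a * c * Q + K * P          ≤⟨ acQ+KP≤ ⟩
    P * (c * X) + K * Q        ≡⟨ cong (_+ K * Q) (rotate P c X) ⟩
    X * c * P + K * Q          ∎)

block : (Fin N → Fin t) → Fin t → Coalition N
block type j p = does (type p ≟ j)

block-type : (type : Fin N → Fin t) {j : Fin t} {p : Fin N} → block type j p ≡ true → type p ≡ j
block-type type {j} {p} p∈block with type p ≟ j
... | yes typeₚ≡j = typeₚ≡j

weight-⊆-block : (a : Vector ℕ t) (type : Fin N → Fin t) (w : Vector ℕ N) → (∀ p → w p ≡ a (type p)) →
                 ∀ {j} (S : Coalition N) → S ⊆ block type j → weight w S ≡ a j * size S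
weight-⊆-block a type w w≡a∘type {j} S S⊆block =
  trans (sum-cong-≗ pointwise) (sym (*-distribˡ-sum (a j) (λ p → if S p then 1 else 0)))
  where
  pointwise : ∀ p → (if S p then w p else 0) ≡ a j * (if S p then 1 else 0)
  pointwise p with S p in p∈S
  ... | true = trans (w≡a∘type p) (trans (cong a (block-type type (S⊆block p p∈S))) (sym (*-identityʳ (a j))))
  ... | false = sym (*-zeroʳ (a j))

weight-⋃-blocks : (type : Fin N → Fin t) (v : Vector ℕ N) (F : Fin t → Coalition N) →
                  (∀ j → F j ⊆ block type j) → weight v (λ p → F (type p) p) ≡ sum (λ j → weight v (F j))
weight-⋃-blocks type v F F⊆block = trans (sum-cong-≗ pointwise) (∑-comm (λ p j → if F j p then v p else 0))
  where
  pointwise : ∀ p → (if F (type p) p then v p else 0) ≡ sum (λ j → if F j p then v p else 0)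
  pointwise p = sym (trans (sum-cong-≗ only-own-type) (sum-singleton (type p) (λ j → if F j p then v p else 0)))
    where
    only-own-type : ∀ j → (if F j p then v p else 0) ≡
                          (if does (j ≟ type p) then (if F j p then v p else 0) else 0)
    only-own-type j with j ≟ type p
    ... | yes _ = refl
    ... | no j≢typeₚ with F j p in p∈Fⱼ
    ...   | true = contradiction (sym (block-type type (F⊆block j p p∈Fⱼ))) j≢typeₚ
    ...   | false = refl

module _ (a : Vector ℕ t) (a>0 : ∀ j → 0 < a j) (type : Fin N → Fin t) (w : Vector ℕ N)
         (w≡a∘type : ∀ p → w p ≡ a (type p))
         (crowded : ∀ j → 1 + ∏ (a [ j ]≔ 1) ≤ size (block type j))
         {Q : ℕ} {w′ : Vector ℕ N}
         (wins : ∀ S → ∏ a ≤ weight w S → Q ≤ weight w′ S)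
         (loses : ∀ S → weight w S < ∏ a → weight w′ S < Q)
         (x : Fin N) {c : Vector ℕ t} (c-comb : PredProductCombination a (type x) c) where

  private
    P = ∏ a
    i = type x

    cofactor : Fin t → ℕ
    cofactor j = ∏ (a [ j ]≔ 1)

    others : Fin t → Coalition N
    others j = block type j ∖ ⁅ x ⁆

    m T : Fin t → ℕ
    m j = size (others j)
    T j = weight w′ (others j)

    x∉others : ∀ j → others j x ≡ false
    x∉others j = trans (cong (λ b → block type j x ∧ not b) (⁅⁆-self x)) (∧-zeroʳ (block type j x))

    weight-⊆-others : ∀ j S → S ⊆ others j → weight w S ≡ a j * size S
    weight-⊆-others j S S⊆others =
      weight-⊆-block a type w w≡a∘type S (λ p → ∖-⊆ (block type j) ⁅ x ⁆ p ∘ S⊆others p)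

    cofactor≤m : ∀ j → cofactor j ≤ m j
    cofactor≤m j = +-cancelˡ-≤ 1 _ _ (≤-trans (crowded j) (size-≤-suc-size-∖⁅⁆ (block type j) x))

    m>0 : ∀ j → 0 < m j
    m>0 j = ≤-trans (∏-[]≔1-pos a a>0 j) (cofactor≤m j)

    -- The cofactor j lightest players of type j weigh P under w, so they win under w′.
    block-average : ∀ j → m j * Q ≤ cofactor j * T j
    block-average j with lightest-subcoalition w′ (others j) refl (cofactor≤m j)
    ... | S , S⊆others , size≡cofactor , ineq = ≤-trans (*-monoʳ-≤ (m j) (wins S P≤wS)) ineq
      where P≤wS : P ≤ weight w S
            P≤wS = ≤-reflexive (sym (trans (weight-⊆-others j S S⊆others)
                                           (trans (cong (a j *_) size≡cofactor) (lookup-*-∏-[]≔1 a j))))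

    c<cofactor : ∀ j → c j < cofactor j
    c<cofactor j = *-cancelˡ-< (a j) (c j) (cofactor j) (begin-strict
      a j * c j        ≤⟨ lookup-≤-sum (λ j → a j * c j) j ⟩
      a · c            <⟨ n<1+n (a · c) ⟩
      1 + a · c        ≡⟨ proj₁ c-comb ⟩
      P                ≡⟨ lookup-*-∏-[]≔1 a j ⟨
      a j * cofactor j ∎)
      where open ≤-Reasoning

    heavy : ∀ j → ∃ λ S → S ⊆ others j × size S ≡ c j × c j * T j ≤ m j * weight w′ S
    heavy j = heaviest-subcoalition w′ (others j) refl (≤-trans (<⇒≤ (c<cofactor j)) (cofactor≤m j))

    V : Fin t → ℕ
    V j = weight w′ (proj₁ (heavy j))

    heavy⊆others : ∀ j → proj₁ (heavy j) ⊆ others j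
    heavy⊆others j = proj₁ (proj₂ (heavy j))

    size-heavy : ∀ j → size (proj₁ (heavy j)) ≡ c j
    size-heavy j = proj₁ (proj₂ (proj₂ (heavy j)))

    heavy-average : ∀ j → c j * T j ≤ m j * V j
    heavy-average j = proj₂ (proj₂ (proj₂ (heavy j)))

    -- The heaviest c j players of each type j together weigh a · c = P − 1, so they lose.
    heavy-loses : sum V < Q
    heavy-loses = subst (_< Q) (weight-⋃-blocks type w′ H H⊆block) (loses (λ p → H (type p) p) wH<P)
      where
      H : Fin t → Coalition N
      H j = proj₁ (heavy j)
      H⊆block : ∀ j → H j ⊆ block type j
      H⊆block j p = ∖-⊆ (block type j) ⁅ x ⁆ p ∘ heavy⊆others j p
      wH≡a·c : weight w (λ p → H (type p) p) ≡ a · c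
      wH≡a·c = trans (weight-⋃-blocks type w H H⊆block)
                     (sum-cong-≗ λ j → trans (weight-⊆-others j (H j) (heavy⊆others j)) (cong (a j *_) (size-heavy j)))
      wH<P : weight w (λ p → H (type p) p) < P
      wH<P = subst (_< P) (sym wH≡a·c) (≤-reflexive (proj₁ c-comb))

    V-bound : ∀ j → a j * c j * Q ≤ P * V j
    V-bound j = begin
      a j * c j * Q             ≡⟨ *-assoc (a j) (c j) Q ⟩
      a j * (c j * Q)           ≤⟨ *-monoʳ-≤ (a j) cⱼQ≤cofactorⱼVⱼ ⟩
      a j * (cofactor j * V j)  ≡⟨ *-assoc (a j) (cofactor j) (V j) ⟨
      a j * cofactor j * V j    ≡⟨ cong (_* V j) (lookup-*-∏-[]≔1 a j) ⟩
      P * V j                   ∎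
      where
      open ≤-Reasoning
      cⱼQ≤cofactorⱼVⱼ : c j * Q ≤ cofactor j * V j
      cⱼQ≤cofactorⱼVⱼ = cross-≤-trans {p = cofactor j} {c = c j} (m>0 j) (block-average j) (heavy-average j)

    except-bound : a · c * Q + P * V i ≤ P * sum V + a i * c i * Q
    except-bound = subst₂ (λ u z → u + P * V i ≤ z + a i * c i * Q)
                          (sym (*-distribʳ-sum Q (λ j → a j * c j))) (sym (*-distribˡ-sum P V))
                          (sum-mono-≤-except i (λ j _ → V-bound j))

    excess : P * V i + P ≤ Q + a i * c i * Q
    excess = excess-bound {B = a i * c i} (proj₁ c-comb) except-bound heavy-loses

    P≤Q : P ≤ Q
    P≤Q = prod≤quota {B = a i * c i} excess (V-bound i)

    K = pred (cofactor i)

    P≡aᵢ[1+K] : a i * suc K ≡ P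
    P≡aᵢ[1+K] = trans (cong (a i *_) (suc-pred (cofactor i) {{>-nonZero (∏-[]≔1-pos a a>0 i)}}))
                      (lookup-*-∏-[]≔1 a i)

    K≤aᵢcᵢ : K ≤ a i * c i
    K≤aᵢcᵢ = ≤-trans (pred-mono-≤ (proj₂ c-comb)) ≤-refl

    light : ∃ λ S → S ⊆ others i × size S ≡ K × m i * weight w′ S ≤ K * T i
    light = lightest-subcoalition w′ (others i) refl (≤-trans pred[n]≤n (cofactor≤m i))

    L = weight w′ (proj₁ light)

    light-average : m i * L ≤ K * T i
    light-average = proj₂ (proj₂ (proj₂ light))

    -- x together with the K lightest other players of its type weighs a i (1 + K) = P, so it wins.
    x+light-wins : Q ≤ w′ x + L
    x+light-wins = subst (Q ≤_) (weight-⁅⁆∪ w′ S x x∉S) (wins (⁅ x ⁆ ∪ S) (≤-reflexive (sym w[⁅x⁆∪S]≡P)))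
      where
      S = proj₁ light
      x∉S : S x ≡ false
      x∉S with S x in x∈S
      ... | false = refl
      ... | true = contradiction (trans (sym (proj₁ (proj₂ light) x x∈S)) (x∉others i)) λ ()
      w[⁅x⁆∪S]≡P : weight w (⁅ x ⁆ ∪ S) ≡ P
      w[⁅x⁆∪S]≡P = begin
        weight w (⁅ x ⁆ ∪ S)   ≡⟨ weight-⁅⁆∪ w S x x∉S ⟩
        w x + weight w S       ≡⟨ cong₂ _+_ (w≡a∘type x) (weight-⊆-others i S (proj₁ (proj₂ light))) ⟩
        a i + a i * size S     ≡⟨ cong (λ z → a i + a i * z) (proj₁ (proj₂ (proj₂ light))) ⟩
        a i + a i * K          ≡⟨ *-suc (a i) K ⟨
        a i * suc K            ≡⟨ P≡aᵢ[1+K] ⟩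
        P                      ∎
        where open ≡-Reasoning

  weight-≤-any-representation : w x ≤ w′ x
  weight-≤-any-representation = subst (_≤ w′ x) (sym (w≡a∘type x)) aᵢ≤w′x
    where
    aᵢ≤w′x : a i ≤ w′ x
    aᵢ≤w′x with c i ℕ.≟ 0
    ... | no cᵢ≢0 = ≤-of-averages (a>0 i) (n≢0⇒n>0 cᵢ≢0) P≡aᵢ[1+K] K≤aᵢcᵢ P≤Q
                      (combine-averages {a i} {K} {c i} P≡aᵢ[1+K] excess cᵢQ≤)
      where
      open ≤-Reasoning
      cᵢL≤KVᵢ : c i * L ≤ K * V i
      cᵢL≤KVᵢ = cross-≤-trans {p = K} {c = c i} (m>0 i) light-average (heavy-average i)
      cᵢQ≤ : c i * Q ≤ c i * w′ x + K * V i
      cᵢQ≤ = begin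
        c i * Q                ≤⟨ *-monoʳ-≤ (c i) x+light-wins ⟩
        c i * (w′ x + L)       ≡⟨ *-distribˡ-+ (c i) (w′ x) L ⟩
        c i * w′ x + c i * L   ≤⟨ +-monoʳ-≤ (c i * w′ x) cᵢL≤KVᵢ ⟩
        c i * w′ x + K * V i   ∎
    ... | yes cᵢ≡0 = begin
        a i          ≡⟨ *-identityʳ (a i) ⟨
        a i * 1      ≡⟨ cong (λ k → a i * suc k) K≡0 ⟨
        a i * suc K  ≡⟨ P≡aᵢ[1+K] ⟩
        P            ≤⟨ P≤Q ⟩
        Q            ≤⟨ x+light-wins ⟩
        w′ x + L     ≡⟨ cong (w′ x +_) L≡0 ⟩
        w′ x + 0     ≡⟨ +-identityʳ (w′ x) ⟩
        w′ x         ∎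
      where
      open ≤-Reasoning
      K≡0 : K ≡ 0
      K≡0 = n≤0⇒n≡0 (subst (K ≤_) (trans (cong (a i *_) cᵢ≡0) (*-zeroʳ (a i))) K≤aᵢcᵢ)
      L≡0 : L ≡ 0
      L≡0 = n≤0⇒n≡0 (*-cancelˡ-≤ (m i) {{>-nonZero (m>0 i)}}
              (subst (m i * L ≤_) (trans (cong (_* T i) K≡0) (sym (*-zeroʳ (m i)))) light-average))

foldr-tabulate : {B : Set} (g : A → B → B) (e : B) (f : Vector A n) →
                 List.foldr g e (List.tabulate f) ≡ foldr g e f
foldr-tabulate {n = zero} g e f = refl
foldr-tabulate {n = suc n} g e f = cong (g (f zero)) (foldr-tabulate g e (f ∘ suc))

foldr-map-allFin : {B : Set} (g : A → B → B) (e : B) (f : Vector A n) →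
                   List.foldr g e (List.map f (List.allFin n)) ≡ foldr g e f
foldr-map-allFin g e f = trans (cong (List.foldr g e) (Listₚ.map-tabulate id f)) (foldr-tabulate g e f)

weightOf-tabulate : (w : Vector ℕ N) (S : Coalition N) → weightOf w (Vec.tabulate S) ≡ weight w S
weightOf-tabulate w S =
  trans (foldr-map-allFin _+_ 0 (λ p → if Vec.lookup (Vec.tabulate S) p then w p else 0))
        (weight-cong w (Vecₚ.lookup∘tabulate S))

module _ {P Q : ℕ} {w w′ : Vector ℕ N} (same : SameGame (ℤ.+ P) w (ℤ.+ Q) w′) where

  wins-same : ∀ S → P ≤ weight w S → Q ≤ weight w′ S
  wins-same S P≤wS = subst (Q ≤_) (weightOf-tabulate w′ S)
    (drop‿+≤+ (proj₁ (same (Vec.tabulate S)) (ℤ.+≤+ (subst (P ≤_) (sym (weightOf-tabulate w S)) P≤wS))))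

  loses-same : ∀ S → weight w S < P → weight w′ S < Q
  loses-same S wS<P = ≰⇒> λ Q≤w′S → <⇒≱ wS<P (subst (P ≤_) (weightOf-tabulate w S)
    (drop‿+≤+ (proj₂ (same (Vec.tabulate S)) (ℤ.+≤+ (subst (Q ≤_) (sym (weightOf-tabulate w′ S)) Q≤w′S)))))

count : Fin t → List.List (Fin t) → ℕ
count j xs = ListAction.sum (List.map (λ k → if does (k ≟ j) then 1 else 0) xs)

lookup-map : {B : Set} (f : A → B) (xs : List.List A) (p : Fin (List.length (List.map f xs))) →
             List.lookup (List.map f xs) p ≡ f (List.lookup xs (cast (Listₚ.length-map f xs) p))
lookup-map f (x List.∷ xs) zero = refl
lookup-map f (x List.∷ xs) (suc p) = lookup-map f xs p

size-block-lookup : (xs : List.List (Fin t)) .(eq : N ≡ List.length xs) (j : Fin t) →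
                    size (block (λ p → List.lookup xs (cast eq p)) j) ≡ count j xs
size-block-lookup {N = zero} List.[] eq j = refl
size-block-lookup {N = suc N} (k List.∷ xs) eq j =
  cong ((if does (k ≟ j) then 1 else 0) +_) (size-block-lookup xs (cong pred eq) j)

minimum-representation : (a : Vector ℕ t) → (∀ j → 0 < a j) → gcdᵛ a ≡ 1 → (xs : List.List (Fin t)) →
  (∀ j → 1 + ∏ (a [ j ]≔ 1) ≤ count j xs) → IsMinimumIntRep (ℤ.+ ∏ a) (List.lookup (List.map a xs))
-- A negative quota would make the empty coalition win.
minimum-representation a a>0 gcd≡1 xs crowded ℤ.-[1+ q ] w′ same x =
  contradiction (subst (∏ a ≤_) (trans (weightOf-tabulate w ∅) (weight-empty w (λ _ → refl)))
                       (drop‿+≤+ (proj₂ (same (Vec.tabulate ∅)) ℤ.-≤+)))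
                (<⇒≱ (∏-pos a>0))
  where
  w = List.lookup (List.map a xs)
  ∅ : Coalition _
  ∅ _ = false
minimum-representation a a>0 gcd≡1 xs crowded (ℤ.+ Q) w′ same x =
  weight-≤-any-representation a a>0 type (List.lookup (List.map a xs)) (lookup-map a xs)
    (λ j → subst (1 + ∏ (a [ j ]≔ 1) ≤_) (sym (size-block-lookup xs (Listₚ.length-map a xs) j)) (crowded j))
    (wins-same same) (loses-same same) x (proj₂ (pred-∏-combination a a>0 (type x) gcd≡1))
  where
  type : Fin (List.length (List.map a xs)) → Fin _
  type p = List.lookup xs (cast (Listₚ.length-map a xs) p)

blockTypes : (Fin t → ℕ) → List.List (Fin t)
blockTypes {t} ns = List.concatMap (λ k → List.replicate (ns k) k) (List.allFin t)

blockWeights≡map-blockTypes : (a ns : Fin t → ℕ) → blockWeights a ns ≡ List.map a (blockTypes ns)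
blockWeights≡map-blockTypes {t} a ns = sym (map-concatMap (List.allFin t))
  where
  map-concatMap : ∀ ks → List.map a (List.concatMap (λ k → List.replicate (ns k) k) ks) ≡
                         List.concatMap (λ k → List.replicate (ns k) (a k)) ks
  map-concatMap List.[] = refl
  map-concatMap (k List.∷ ks) = trans (Listₚ.map-++ a (List.replicate (ns k) k) _)
                                      (cong₂ List._++_ (Listₚ.map-replicate a (ns k) k) (map-concatMap ks))

count-++ : (j : Fin t) (xs ys : List.List (Fin t)) → count j (xs List.++ ys) ≡ count j xs + count j ys
count-++ j xs ys =
  trans (cong ListAction.sum (Listₚ.map-++ indicator xs ys)) (ListAction.sum-++ (List.map indicator xs) _)
  where indicator : Fin _ → ℕ
        indicator k = if does (k ≟ j) then 1 else 0

count-replicate : (j k : Fin t) (r : ℕ) → count j (List.replicate r k) ≡ (if does (k ≟ j) then r else 0)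
count-replicate j k zero with k ≟ j
... | yes _ = refl
... | no _ = refl
count-replicate j k (suc r) with k ≟ j | count-replicate j k r
... | yes _ | eq = cong suc eq
... | no _ | eq = eq

count-blockTypes : (ns : Fin t → ℕ) (j : Fin t) → count j (blockTypes ns) ≡ ns j
count-blockTypes {t} ns j = trans (count-concatMap (List.allFin t))
  (trans (foldr-map-allFin _+_ 0 (λ k → if does (k ≟ j) then ns k else 0)) (sum-singleton j ns))
  where
  count-concatMap : ∀ ks → count j (List.concatMap (λ k → List.replicate (ns k) k) ks) ≡
                           ListAction.sum (List.map (λ k → if does (k ≟ j) then ns k else 0) ks)
  count-concatMap List.[] = refl
  count-concatMap (k List.∷ ks) = trans (count-++ j (List.replicate (ns k) k) _)
                                        (cong₂ _+_ (count-replicate j k (ns k)) (count-concatMap ks))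

open import Data.Fin using (toℕ)
open import Data.List using (length; lookup)
open import Data.Integer using (+_)

mainTheorem7 : (t : ℕ) (a ns : Fin t → ℕ) →
    (∀ i j → toℕ i < toℕ j → a j < a i) →
    (∀ i → 0 < a i) →
    gcdAll a ≡ 1 →
    (∀ i → 1 + 2 * prodExcept a i ≤ ns i) →
    IsMinimumIntRep {length (blockWeights a ns)} (+ prodAll a) (lookup (blockWeights a ns))
mainTheorem7 t a ns _ a>0 gcd≡1 ns≥ =
  subst (λ ws → IsMinimumIntRep {length ws} (+ prodAll a) (lookup ws)) (sym (blockWeights≡map-blockTypes a ns))
    (subst (λ P → IsMinimumIntRep (+ P) (lookup (List.map a (blockTypes ns)))) (sym (foldr-map-allFin _*_ 1 a))
      (minimum-representation a a>0 (trans (sym (foldr-map-allFin gcd 0 a)) gcd≡1) (blockTypes ns) crowded))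
  where
  crowded : ∀ j → 1 + ∏ (a [ j ]≔ 1) ≤ count j (blockTypes ns)
  crowded j = subst₂ (λ pe n → 1 + pe ≤ n) (foldr-map-allFin _*_ 1 (a [ j ]≔ 1)) (sym (count-blockTypes ns j))
                     (≤-trans (+-monoʳ-≤ 1 (m≤m+n (prodExcept a j) _)) (ns≥ j))
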